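{- Let $p$ be a propositional atom and let $H$ be a closed generic theory. Let $(T_{KP})_0$ be the smallest closed theory containing $H$ and the formula $p\leftrightarrow\mathrm{K}\neg p$, and let $T_{KP}=(T_{KP})_0\cup\mathbf{T}$. Then for every set $S$ of propositional atoms with $p\notin S$, $\mathscr M_{(T_{KP})_0,S}\models T_{KP}$. In particular, $T_{KP}$ is consistent.
   Context: Fix a nonempty set of symbols called propositional atoms and a symbol $\mathrm{K}$ which is not a propositional atom. Formulas are defined recursively: every propositional atom is a formula; if $\varphi,\psi$ are formulas then so are $\neg\varphi$, $(\varphi\wedge\psi)$, $(\varphi\vee\psi)$, $(\varphi\rightarrow\psi)$; if $\varphi$ is a formula then so is $\mathrm{K}(\varphi)$. $\varphi\leftrightarrow\psi$ abbreviates $(\varphi\rightarrow\psi)\wedge(\psi\rightarrow\varphi)$. A formula is basic if it is a propositional atom or of the form $\mathrm{K}\varphi$. A theory is a set of formulas. A model is a function assigning a truth value to every basic formula; truth $\mathscr M\models\varphi$ of an arbitrary formula is defined from the values of basic formulas by the classical truth tables (formulas $\mathrm{K}\varphi$ are treated like atoms). $\mathscr M\models T$ means $\mathscr M\models\varphi$ for all $\varphi\in T$; $T\models\varphi$ means every model of $T$ satisfies $\varphi$; $T$ is consistent if some model satisfies $T$. A theory $T$ is closed if $\varphi\in T$ implies $\mathrm{K}\varphi\in T$. $\mathbf{T}$ is the set of all formulas $\mathrm{K}\varphi\rightarrow\varphi$. For a theory $T$ and a set $S$ of propositional atoms, $\mathscr M_{T,S}$ is the model with $\mathscr M_{T,S}\models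 q$ iff $q\in S$ for atoms $q$, and $\mathscr M_{T,S}\models\mathrm{K}\varphi$ iff $T\models\varphi$. A theory $T$ is closed generic if for every set $S$ of propositional atoms and every closed theory $T'\supseteq T$, $\mathscr M_{T',S}\models T$. -}

module Defs where

open import Data.Bool using (Bool; true; false; not; _∧_; _∨_; if_then_else_)
open import Data.Product using (_×_; Σ)
open import Data.Sum using (_⊎_)
open import Relation.Binary.PropositionalEquality using (_≡_)
open import Relation.Nullary using (¬_; does)
open import Axiom.ExcludedMiddle using (ExcludedMiddle)
open import Level using (0ℓ)

data Formula (A : Set) : Set where
  atom : A → Formula A
  ¬'_  : Formula A → Formula A
  _∧'_ : Formula A → Formula A → Formula A
  _∨'_ : Formula A → Formula A → Formula A
  _⇒'_ : Formula A → Formula A → Formula A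
  K    : Formula A → Formula A

module _ {A : Set} where

  _⇔'_ : Formula A → Formula A → Formula A
  φ ⇔' ψ = (φ ⇒' ψ) ∧' (ψ ⇒' φ)

  Theory : Set₁
  Theory = Formula A → Set

  _⊆_ : Theory → Theory → Set
  T ⊆ T' = ∀ φ → T φ → T' φ

  _∪_ : Theory → Theory → Theory
  (T ∪ T') φ = T φ ⊎ T' φ

  -- A model assigns a truth value to every basic formula:
  -- to every atom q and to every formula of the form K φ.
  record Model : Set where
    constructor model
    field
      atomVal : A → Bool
      kVal    : Formula A → Bool
  open Model public

  ⟦_⟧ : Formula A → Model → Bool
  ⟦ atom q ⟧ M = atomVal M q
  ⟦ ¬' φ ⟧ M = not (⟦ φ ⟧ M)
  ⟦ φ ∧' ψ ⟧ M = ⟦ φ ⟧ M ∧ ⟦ ψ ⟧ M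
  ⟦ φ ∨' ψ ⟧ M = ⟦ φ ⟧ M ∨ ⟦ ψ ⟧ M
  ⟦ φ ⇒' ψ ⟧ M = not (⟦ φ ⟧ M) ∨ ⟦ ψ ⟧ M
  ⟦ K φ ⟧ M = kVal M φ

  _⊨_ : Model → Formula A → Set
  M ⊨ φ = ⟦ φ ⟧ M ≡ true

  _⊨Th_ : Model → Theory → Set
  M ⊨Th T = ∀ φ → T φ → M ⊨ φ

  _⊨ᵀ_ : Theory → Formula A → Set
  T ⊨ᵀ φ = ∀ (M : Model) → M ⊨Th T → M ⊨ φ

  Consistent : Theory → Set
  Consistent T = Σ Model (λ M → M ⊨Th T)

  Closed : Theory → Set
  Closed T = ∀ φ → T φ → T (K φ)

  data 𝐓 : Theory where
    refl-ax : ∀ φ → 𝐓 (K φ ⇒' φ)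

  data KClosure (T : Theory) : Theory where
    base  : ∀ {φ} → T φ → KClosure T φ
    kstep : ∀ {φ} → KClosure T φ → KClosure T (K φ)

  data ⟨_⟩ (ψ : Formula A) : Theory where
    here : ⟨ ψ ⟩ ψ

  -- The model M_{T,S}. Its definition (K φ true iff T ⊨ φ) is classical,
  -- so it is defined relative to the law of excluded middle.
  module Classical (lem : ExcludedMiddle 0ℓ) where

    M[_,_] : Theory → (A → Set) → Model
    M[ T , S ] = model (λ q → does (lem {S q})) (λ φ → does (lem {T ⊨ᵀ φ}))

    ClosedGeneric : Theory → Set₁
    ClosedGeneric T = ∀ (S : A → Set) (T' : Theory) →
      Closed T' → T ⊆ T' → M[ T' , S ] ⊨Th T

{-# OPTIONS --safe #-}
-- Read K as "is entailed by T₀".  The only part of T₀ not settled by genericity of H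
-- or by closure is the axiom p ⇔ K ¬p.  In a model with p false it holds as soon as
-- T₀ ⊭ ¬p, and that is witnessed by M_{U,S} for the theory U of all formulas (closed
-- and inconsistent, so every K φ is true there) and any S containing p.
-- Finally every M_{T,S} satisfying T satisfies 𝐓: if K φ is true then T ⊨ φ, so φ is true.
module Submission where

open import Defs
open import Data.Bool using (true; false; not)
open import Data.Product using (_×_; _,_)
open import Data.Sum using (inj₁; inj₂)
open import Data.Unit using (tt)
open import Data.Empty using (⊥)
open import Relation.Nullary using (¬_; yes; no)
open import Relation.Nullary.Decidable using (dec-true; dec-false)
open import Relation.Unary using (U)
open import Relation.Binary.PropositionalEquality using (_≡_; refl; sym; trans; cong)
open import Axiom.ExcludedMiddle using (ExcludedMiddle)
open import Level using (0ℓ)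

module _ {A : Set} where

  ⊨Th-∪ : {M : Model} {T T' : Theory {A}} → M ⊨Th T → M ⊨Th T' → M ⊨Th (T ∪ T')
  ⊨Th-∪ M⊨T M⊨T' φ (inj₁ t) = M⊨T φ t
  ⊨Th-∪ M⊨T M⊨T' φ (inj₂ t) = M⊨T' φ t

  ⊨-⇔ : (M : Model) (φ ψ : Formula A) → ⟦ φ ⟧ M ≡ ⟦ ψ ⟧ M → M ⊨ (φ ⇔' ψ)
  ⊨-⇔ M φ ψ eq rewrite eq with ⟦ ψ ⟧ M
  ... | true  = refl
  ... | false = refl

  ⊨-⇒ : (M : Model) (φ ψ : Formula A) → (M ⊨ φ → M ⊨ ψ) → M ⊨ (φ ⇒' ψ)
  ⊨-⇒ M φ ψ imp with ⟦ φ ⟧ M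
  ... | true  = imp refl
  ... | false = refl

  ∈⇒⊨ᵀ : {T : Theory {A}} (φ : Formula A) → T φ → T ⊨ᵀ φ
  ∈⇒⊨ᵀ φ t M M⊨T = M⊨T φ t

  ⊨-¬-contradiction : (M : Model) (φ : Formula A) → M ⊨ φ → ¬ (M ⊨ (¬' φ))
  ⊨-¬-contradiction M φ M⊨φ M⊨¬φ with () ← trans (sym (cong not M⊨φ)) M⊨¬φ

  ⊨ᵀ-contradiction : {T : Theory {A}} (ψ φ : Formula A) → T ψ → T (¬' ψ) → T ⊨ᵀ φ
  ⊨ᵀ-contradiction ψ φ tψ t¬ψ M M⊨T
    with () ← ⊨-¬-contradiction M ψ (M⊨T ψ tψ) (M⊨T (¬' ψ) t¬ψ)

  KClosure-closed : (T : Theory {A}) → Closed (KClosure T)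
  KClosure-closed T φ = kstep

  ⊨Th-KClosure : {M : Model} {T : Theory {A}} →
    M ⊨Th T → (∀ φ → KClosure T φ → M ⊨ K φ) → M ⊨Th KClosure T
  ⊨Th-KClosure M⊨T M⊨K φ (base t)        = M⊨T φ t
  ⊨Th-KClosure M⊨T M⊨K _ (kstep {φ} t) = M⊨K φ t

  U-closed : Closed {A} U
  U-closed _ _ = tt

  U-⊨ᵀ : (φ : Formula A) → U ⊨ᵀ φ
  U-⊨ᵀ φ = ⊨ᵀ-contradiction φ φ tt tt

  module _ (lem : ExcludedMiddle 0ℓ) where
    open Classical {A} lem

    M[,]-⊨K : (T : Theory {A}) (S : A → Set) (φ : Formula A) → T ⊨ᵀ φ → M[ T , S ] ⊨ K φ
    M[,]-⊨K T S φ = dec-true lem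

    M[,]-⊭K : (T : Theory {A}) (S : A → Set) (φ : Formula A) →
      ¬ (T ⊨ᵀ φ) → ⟦ K φ ⟧ M[ T , S ] ≡ false
    M[,]-⊭K T S φ = dec-false lem

    M[KClosure,]-⊨Th : (T : Theory {A}) (S : A → Set) →
      M[ KClosure T , S ] ⊨Th T → M[ KClosure T , S ] ⊨Th KClosure T
    M[KClosure,]-⊨Th T S M⊨T = ⊨Th-KClosure M⊨T (λ φ t → M[,]-⊨K (KClosure T) S φ (∈⇒⊨ᵀ φ t))

    M[,]-⊨K⇒⊨ᵀ : (T : Theory {A}) (S : A → Set) (φ : Formula A) → M[ T , S ] ⊨ K φ → T ⊨ᵀ φ
    M[,]-⊨K⇒⊨ᵀ T S φ with lem {T ⊨ᵀ φ}
    ... | yes T⊨φ = λ _ → T⊨φ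
    ... | no _    = λ ()

    M[,]-⊨𝐓 : (T : Theory {A}) (S : A → Set) → M[ T , S ] ⊨Th T → M[ T , S ] ⊨Th 𝐓
    M[,]-⊨𝐓 T S M⊨T _ (refl-ax φ) =
      ⊨-⇒ M[ T , S ] (K φ) φ (λ ⊨Kφ → M[,]-⊨K⇒⊨ᵀ T S φ ⊨Kφ M[ T , S ] M⊨T)

    M[U,]-⊨Th-KClosure : (T : Theory {A}) (S : A → Set) →
      M[ U , S ] ⊨Th T → M[ U , S ] ⊨Th KClosure T
    M[U,]-⊨Th-KClosure T S M⊨T = ⊨Th-KClosure M⊨T (λ φ _ → M[,]-⊨K U S φ (U-⊨ᵀ φ))

    module _ {H : Theory {A}} (gen : ClosedGeneric H) (p : A) where

      private
        T₀ : Theory {A}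
        T₀ = KClosure (H ∪ ⟨ atom p ⇔' K (¬' atom p) ⟩)

      M[U,U]-⊨T₀ : M[ U , U ] ⊨Th T₀
      M[U,U]-⊨T₀ = M[U,]-⊨Th-KClosure _ U (⊨Th-∪ (gen U U U-closed (λ _ _ → tt)) ⊨KP)
        where
        ⊨KP : M[ U , U ] ⊨Th ⟨ atom p ⇔' K (¬' atom p) ⟩
        ⊨KP _ here = ⊨-⇔ M[ U , U ] (atom p) (K (¬' atom p))
          (trans (dec-true lem tt) (sym (M[,]-⊨K U U (¬' atom p) (U-⊨ᵀ (¬' atom p)))))

      T₀⊭¬p : ¬ (T₀ ⊨ᵀ (¬' atom p))
      T₀⊭¬p T₀⊨¬p =
        ⊨-¬-contradiction M[ U , U ] (atom p) (dec-true lem tt) (T₀⊨¬p M[ U , U ] M[U,U]-⊨T₀)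

      M[T₀,]-⊨T₀ : (S : A → Set) → ¬ S p → M[ T₀ , S ] ⊨Th T₀
      M[T₀,]-⊨T₀ S ¬Sp = M[KClosure,]-⊨Th _ S (⊨Th-∪ (gen S T₀ (KClosure-closed _) ⊆T₀) ⊨KP)
        where
        ⊆T₀ : H ⊆ T₀
        ⊆T₀ φ h = base (inj₁ h)

        ⊨KP : M[ T₀ , S ] ⊨Th ⟨ atom p ⇔' K (¬' atom p) ⟩
        ⊨KP _ here = ⊨-⇔ M[ T₀ , S ] (atom p) (K (¬' atom p))
          (trans (dec-false lem ¬Sp) (sym (M[,]-⊭K T₀ S (¬' atom p) T₀⊭¬p)))

      M[T₀,]-⊨T₀∪𝐓 : (S : A → Set) → ¬ S p → M[ T₀ , S ] ⊨Th (T₀ ∪ 𝐓)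
      M[T₀,]-⊨T₀∪𝐓 S ¬Sp = ⊨Th-∪ (M[T₀,]-⊨T₀ S ¬Sp) (M[,]-⊨𝐓 T₀ S (M[T₀,]-⊨T₀ S ¬Sp))

theorem20 : (lem : ExcludedMiddle 0ℓ) → {A : Set} → (p : A) → (H : Theory {A}) →
    Classical.ClosedGeneric lem H →
      let TKP0 = KClosure (H ∪ ⟨ atom p ⇔' K (¬' atom p) ⟩)
          TKP = TKP0 ∪ 𝐓
      in ((S : A → Set) → ¬ S p → Classical.M[_,_] lem TKP0 S ⊨Th TKP)
         × Consistent TKP
theorem20 lem p H gen =
  M[T₀,]-⊨T₀∪𝐓 lem gen p , (_ , M[T₀,]-⊨T₀∪𝐓 lem gen p (λ _ → ⊥) (λ ()))
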